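{- Let $A$ and $B$ be finite alphabets and $f:A^*\to B^*$ a morphism. Then $f(\mathbf{w})$ has bounded Abelian complexity for every infinite word $\mathbf{w}$ over $A$ if and only if there exists a vector $\vec v\in\mathbb{N}^{\#B}$ such that for each letter $a\in A$ there is an integer $K_a$ with $\Psi(f(a))=K_a\vec v$.
   Context: $\mathbb{N}$ includes $0$. For a word $x$ over $B=\{b_1,\dots,b_m\}$, $\Psi(x)=(|x|_{b_1},\dots,|x|_{b_m})$ is its Parikh vector, where $|x|_b$ is the number of occurrences of $b$ in $x$. Two words are Abelian equivalent if they have the same Parikh vector. The Abelian complexity of an (infinite, or possibly finite) word $\mathbf{x}$ is the function $n\mapsto$ number of Abelian equivalence classes among factors of $\mathbf{x}$ of length $n$; it is bounded if this function is bounded (which holds trivially if $f(\mathbf{w})$ is finite, as may happen if $f$ is erasing). -}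

module Defs where

open import Data.Nat using (ℕ; _≤_)
open import Data.Fin using (Fin)
open import Data.Fin.Properties using (_≟_)
open import Data.List using (List; []; _∷_; _++_; length; filter; map; concatMap; upTo)
open import Data.Product using (Σ; ∃; ∃-syntax; _×_; _,_)
open import Data.List.Relation.Unary.AllPairs using (AllPairs)
open import Data.List.Relation.Unary.All using (All)
open import Data.Integer using (ℤ; +_; _*_)
open import Relation.Binary.PropositionalEquality using (_≡_)
open import Relation.Nullary using (¬_)

count : ∀ {m} → Fin m → List (Fin m) → ℕ
count b x = length (filter (b ≟_) x)

Ψ : ∀ {m} → List (Fin m) → Fin m → ℕ
Ψ x b = count b x

_~ab_ : ∀ {m} → List (Fin m) → List (Fin m) → Set
x ~ab y = ∀ b → Ψ x b ≡ Ψ y b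

Morphism : ℕ → ℕ → Set
Morphism k m = Fin k → List (Fin m)

apply : ∀ {k m} → Morphism k m → List (Fin k) → List (Fin m)
apply f u = concatMap f u

InfWord : ℕ → Set
InfWord k = ℕ → Fin k

prefix : ∀ {k} → InfWord k → ℕ → List (Fin k)
prefix w j = map w (upTo j)

IsInfix : ∀ {m} → List (Fin m) → List (Fin m) → Set
IsInfix x y = ∃[ p ] ∃[ s ] (p ++ x ++ s ≡ y)

-- x is a factor of the (finite or infinite) word f(w) = f(w₀)f(w₁)f(w₂)…
-- (every factor of f(w) lies inside f(w₀…w_{j-1}) for some j)
IsFactorOfImage : ∀ {k m} → Morphism k m → InfWord k → List (Fin m) → Set
IsFactorOfImage f w x = ∃[ j ] IsInfix x (apply f (prefix w j))

-- f(w) has bounded Abelian complexity: there is C such that for every n,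
-- the number of Abelian classes of factors of length n is ≤ C, i.e. any list
-- of length-n factors which are pairwise not Abelian equivalent has length ≤ C.
BoundedAbelianComplexity : ∀ {k m} → Morphism k m → InfWord k → Set
BoundedAbelianComplexity f w =
  ∃[ C ] ∀ (n : ℕ) (xs : List (List _)) →
    All (λ x → IsFactorOfImage f w x × length x ≡ n) xs →
    AllPairs (λ x y → ¬ (x ~ab y)) xs →
    length xs ≤ C

module Submission where

-- (⇐) If Ψ(f a) = K_a · v, then Ψ(f u) = K(u) · v is determined by |f u|.  Every
-- factor x of f(w) is completed to an image f u by a head piece of some image
-- on the left and a tail piece on the right ("a frame"); there are finitely
-- many frames, and two factors of equal length with the same frame are Abelian
-- equivalent.  By the pigeonhole principle the number of Abelian classes of
-- each length is at most the number of frames.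
-- (⇒) If Ψ(f a) and Ψ(f a') are not parallel, then in f(a² a'² a³ a'³ …)
-- the factors f(a^(i·p) a'^((t−i)·q)), i ≤ t, with p = |f a'| and q = |f a|,
-- have equal length and pairwise distinct Parikh vectors, so the complexity is
-- unbounded.  Hence all 2×2 minors of the Parikh matrix vanish, and then every
-- Ψ(f a) is a natural multiple of the primitive vector (entries with gcd 1) on
-- the common line, found by dividing a nonzero Ψ(f a₀) by the gcd of its entries.
-- Integer coefficients K_a reduce to natural ones via |K_a|.

open import Defs

open import Data.Bool using (true; false)
open import Data.Empty using (⊥-elim)
open import Data.Fin using (Fin; zero; suc)
open import Data.Fin.Properties using (_≟_; any?)
open import Data.Integer using (ℤ; +_; ∣_∣) renaming (_*_ to _*ℤ_)
open import Data.Integer.Properties using (abs-*; pos-*)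
open import Data.List
  using (List; []; _∷_; _++_; length; filter; map; take; drop; upTo; allFin; cartesianProduct;
         replicate; applyUpTo)
open import Data.List.Properties
  using (length-++; length-++-sucʳ; filter-++; ++-assoc; ++-identityʳ; ∷-injective;
         concatMap-++; map-upTo; length-applyUpTo)
open import Data.List.Membership.Propositional using (_∈_)
open import Data.List.Membership.Propositional.Properties
  using (∈-map⁺; ∈-cartesianProduct⁺; ∈-upTo⁺; ∈-allFin; ∈-∃++; ∈-++⁻; ∈-++⁺ˡ; ∈-++⁺ʳ)
open import Data.List.Relation.Unary.All using (All; []; _∷_; reduce)
import Data.List.Relation.Unary.All.Properties as All
open import Data.List.Relation.Unary.AllPairs using (AllPairs; []; _∷_)
import Data.List.Relation.Unary.AllPairs.Properties as AllPairs
open import Data.List.Relation.Unary.Any using (here; there)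
open import Data.List.Relation.Unary.Unique.Propositional using (Unique)
open import Data.Maybe using (Maybe; just; nothing)
import Data.Nat as ℕ
open import Data.Nat using (ℕ; zero; suc; _+_; _*_; _∸_; _≤_; _<_; z≤n; s≤s; _<?_; >-nonZero)
open import Data.Nat.Divisibility using (_∣_; divides; quotient; 0∣⇒≡0; ∣-trans)
open import Data.Nat.GCD using (gcd; gcd[m,n]∣m; gcd[m,n]∣n; gcd-greatest; c*gcd[m,n]≡gcd[cm,cn])
open import Data.Nat.Properties
  using (+-assoc; +-comm; +-suc; +-identityʳ; +-cancelˡ-≡; +-cancelʳ-≡; *-assoc; *-comm;
         *-identityʳ; *-zeroʳ; *-distribʳ-+; *-cancelʳ-≡; *-cancelˡ-≡; ≤-refl; ≤-trans; ≤-pred;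
         m≤m+n; m≤n+m; m≤n⇒m≤1+n; m≤n⇒∃[o]m+o≡n; m∸n≤m; m+n∸m≡n; m+[n∸m]≡n; *-monoˡ-≤;
         *-monoʳ-≤; 1+n≰n; <⇒≢; +-*-semiring)
open import Data.Nat.Tactic.RingSolver using (solve-∀)
open import Algebra.Properties.Semiring.Sum +-*-semiring
  using (sum; sum-cong-≗; sum-replicate-zero; ∑-distrib-+; *-distribˡ-sum)
open import Data.Product using (Σ; ∃-syntax; _×_; _,_; proj₁; proj₂)
open import Data.Sum using (_⊎_; inj₁; inj₂)
open import Function.Base using (_∘_)
open import Function.Bundles using (_⇔_; mk⇔)
open import Relation.Binary.PropositionalEquality
open import Relation.Nullary using (does; ¬_; yes; no)

δ : ∀ {m} → Fin m → Fin m → ℕ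
δ b y with does (b ≟ y)
... | true = 1
... | false = 0

count-∷ : ∀ {m} (b y : Fin m) xs → count b (y ∷ xs) ≡ δ b y + count b xs
count-∷ b y xs with does (b ≟ y)
... | true = refl
... | false = refl

count-++ : ∀ {m} (b : Fin m) xs ys → count b (xs ++ ys) ≡ count b xs + count b ys
count-++ b xs ys = trans (cong length (filter-++ (b ≟_) xs ys)) (length-++ (filter (b ≟_) xs))

∑-δ : ∀ {m} (y : Fin m) → sum (λ b → δ b y) ≡ 1
∑-δ {suc m} zero = cong suc (trans (sum-cong-≗ off-diagonal) (sum-replicate-zero m))
  where
  off-diagonal : ∀ (b : Fin m) → δ (suc b) zero ≡ 0
  off-diagonal b = refl
∑-δ {suc m} (suc y) = trans (sum-cong-≗ (shift y)) (∑-δ y)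
  where
  shift : ∀ {m} (y b : Fin m) → δ (suc b) (suc y) ≡ δ b y
  shift y b with does (b ≟ y)
  ... | true = refl
  ... | false = refl

length≡∑Ψ : ∀ {m} (xs : List (Fin m)) → length xs ≡ sum (Ψ xs)
length≡∑Ψ {m} [] = sym (sum-replicate-zero m)
length≡∑Ψ (y ∷ xs) = sym (begin
  sum (λ b → count b (y ∷ xs))           ≡⟨ sum-cong-≗ (λ b → count-∷ b y xs) ⟩
  sum (λ b → δ b y + count b xs)         ≡⟨ ∑-distrib-+ (λ b → δ b y) (Ψ xs) ⟩
  sum (λ b → δ b y) + sum (Ψ xs)         ≡⟨ cong₂ _+_ (∑-δ y) (sym (length≡∑Ψ xs)) ⟩
  suc (length xs)                        ∎)
  where open ≡-Reasoning

entry≤sum : ∀ {m} (x : Fin m → ℕ) b → x b ≤ sum x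
entry≤sum x zero = m≤m+n _ _
entry≤sum x (suc b) = ≤-trans (entry≤sum (λ c → x (suc c)) b) (m≤n+m _ _)

-- M · Σ v = M' · Σ v implies M · v = M' · v (if Σ v = 0 then v = 0).
cancel-sum : ∀ {m} (v : Fin m → ℕ) M M' → M * sum v ≡ M' * sum v → ∀ b → M * v b ≡ M' * v b
cancel-sum v M M' e b with sum v | entry≤sum v b
... | suc s | _ = cong (_* v b) (*-cancelʳ-≡ M M' (suc s) e)
... | zero | vb≤0 with v b  -- vb≤0 : v b ≤ 0 leaves only the case v b = 0
...   | zero = trans (*-zeroʳ M) (sym (*-zeroʳ M'))

ProportionalImages : ∀ {k m} → Morphism k m → (Fin m → ℕ) → (Fin k → ℕ) → Set
ProportionalImages f v K = ∀ a b → Ψ (f a) b ≡ K a * v b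

weight : ∀ {k} → (Fin k → ℕ) → List (Fin k) → ℕ
weight K [] = 0
weight K (a ∷ u) = K a + weight K u

module Proportional {k m} (f : Morphism k m) (v : Fin m → ℕ) (K : Fin k → ℕ)
                    (prop : ProportionalImages f v K) where

  Ψ-apply : ∀ u b → Ψ (apply f u) b ≡ weight K u * v b
  Ψ-apply [] b = refl
  Ψ-apply (a ∷ u) b = begin
    Ψ (f a ++ apply f u) b          ≡⟨ count-++ b (f a) (apply f u) ⟩
    Ψ (f a) b + Ψ (apply f u) b     ≡⟨ cong₂ _+_ (prop a b) (Ψ-apply u b) ⟩
    K a * v b + weight K u * v b    ≡⟨ *-distribʳ-+ (v b) (K a) (weight K u) ⟨
    (K a + weight K u) * v b        ∎
    where open ≡-Reasoning

  length-apply : ∀ u → length (apply f u) ≡ weight K u * sum v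
  length-apply u = begin
    length (apply f u)                ≡⟨ length≡∑Ψ (apply f u) ⟩
    sum (Ψ (apply f u))               ≡⟨ sum-cong-≗ (Ψ-apply u) ⟩
    sum (λ b → weight K u * v b)      ≡⟨ *-distribˡ-sum (weight K u) v ⟨
    weight K u * sum v                ∎
    where open ≡-Reasoning

  Ψ-apply-by-length : ∀ u u' → length (apply f u) ≡ length (apply f u') →
                      ∀ b → Ψ (apply f u) b ≡ Ψ (apply f u') b
  Ψ-apply-by-length u u' same-length b = begin
    Ψ (apply f u) b       ≡⟨ Ψ-apply u b ⟩
    weight K u * v b      ≡⟨ cancel-sum v (weight K u) (weight K u') weights b ⟩
    weight K u' * v b     ≡⟨ Ψ-apply u' b ⟨
    Ψ (apply f u') b      ∎
    where
    open ≡-Reasoning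
    weights : weight K u * sum v ≡ weight K u' * sum v
    weights = trans (sym (length-apply u)) (trans same-length (length-apply u'))

  framed-equivalent : ∀ (α γ x y : List (Fin m)) u u' → length x ≡ length y →
    α ++ x ++ γ ≡ apply f u → α ++ y ++ γ ≡ apply f u' → x ~ab y
  framed-equivalent α γ x y u u' lx≡ly ex ey b =
    +-cancelʳ-≡ (Ψ γ b) _ _ (+-cancelˡ-≡ (Ψ α b) _ _ (begin
      Ψ α b + (Ψ x b + Ψ γ b)    ≡⟨ Ψ-framed x ⟨
      Ψ (α ++ x ++ γ) b          ≡⟨ cong (λ t → Ψ t b) ex ⟩
      Ψ (apply f u) b            ≡⟨ Ψ-apply-by-length u u' same-length b ⟩
      Ψ (apply f u') b           ≡⟨ cong (λ t → Ψ t b) ey ⟨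
      Ψ (α ++ y ++ γ) b          ≡⟨ Ψ-framed y ⟩
      Ψ α b + (Ψ y b + Ψ γ b)    ∎))
    where
    open ≡-Reasoning
    Ψ-framed : ∀ z → Ψ (α ++ z ++ γ) b ≡ Ψ α b + (Ψ z b + Ψ γ b)
    Ψ-framed z = trans (count-++ b α (z ++ γ)) (cong (_+_ (Ψ α b)) (count-++ b z γ))
    length-framed : ∀ z → length (α ++ z ++ γ) ≡ length α + (length z + length γ)
    length-framed z = trans (length-++ α) (cong (_+_ (length α)) (length-++ z))
    same-length : length (apply f u) ≡ length (apply f u')
    same-length = begin
      length (apply f u)                       ≡⟨ cong length ex ⟨
      length (α ++ x ++ γ)                     ≡⟨ length-framed x ⟩
      length α + (length x + length γ)         ≡⟨ cong (λ t → length α + (t + length γ)) lx≡ly ⟩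
      length α + (length y + length γ)         ≡⟨ length-framed y ⟨
      length (α ++ y ++ γ)                     ≡⟨ cong length ey ⟩
      length (apply f u')                      ∎

++-overlap : ∀ {X : Set} (P y Q z : List X) → P ++ y ≡ Q ++ z →
  (∃[ P' ] (P ≡ Q ++ P' × P' ++ y ≡ z)) ⊎ (∃[ d ] (Q ≡ P ++ d × y ≡ d ++ z))
++-overlap P y [] z e = inj₁ (P , refl , e)
++-overlap [] y (q ∷ Q) z e = inj₂ (q ∷ Q , refl , e)
++-overlap (p ∷ P) y (q ∷ Q) z e with ∷-injective e
... | refl , e' with ++-overlap P y Q z e'
... | inj₁ (P' , refl , e'') = inj₁ (P' , refl , e'')
... | inj₂ (d , refl , e'') = inj₂ (d , refl , e'')

take-length-++ : ∀ {X : Set} (xs ys : List X) → take (length xs) (xs ++ ys) ≡ xs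
take-length-++ [] ys = refl
take-length-++ (x ∷ xs) ys = cong (x ∷_) (take-length-++ xs ys)

drop-length-++ : ∀ {X : Set} (xs ys : List X) → drop (length xs) (xs ++ ys) ≡ ys
drop-length-++ [] ys = refl
drop-length-++ (x ∷ xs) ys = drop-length-++ xs ys

-- A cut of an image f a at position i splits it into the head take i (f a)
-- and the tail drop i (f a); nothing stands for the empty piece.  There are
-- finitely many cuts, and every factor of f(w) becomes an image f(u) once it is
-- completed by the head of one cut on the left and the tail of one on the right.
module Cuts {k m} (f : Morphism k m) where

  Cut : Set
  Cut = Maybe (Fin k × ℕ)

  head-piece : Cut → List (Fin m)
  head-piece nothing = []
  head-piece (just (a , i)) = take i (f a)

  tail-piece : Cut → List (Fin m)
  tail-piece nothing = []
  tail-piece (just (a , i)) = drop i (f a)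

  cuts : List Cut
  cuts = nothing ∷ map just (cartesianProduct (allFin k) (upTo (suc (sum (λ a → length (f a))))))

  cut∈cuts : ∀ a α α' → α ++ α' ≡ f a → just (a , length α) ∈ cuts
  cut∈cuts a α α' e = there (∈-map⁺ just (∈-cartesianProduct⁺ (∈-allFin a) (∈-upTo⁺ (s≤s
    (≤-trans (subst (length α ≤_) (trans (sym (length-++ α)) (cong length e)) (m≤m+n _ _))
             (entry≤sum (λ a → length (f a)) a))))))

  -- If P ++ y is an image, then y, completed on the left by a head piece
  -- instead of P, is again an image (the head of the letter image where P ends).
  complete-left : ∀ L P y → P ++ y ≡ apply f L →
    ∃[ c ] ∃[ u ] (c ∈ cuts × head-piece c ++ y ≡ apply f u)
  complete-left [] [] [] e = nothing , [] , here refl , refl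
  complete-left (a ∷ L) P y e with ++-overlap P y (f a) (apply f L) e
  ... | inj₁ (P' , refl , e') = complete-left L P' y e'
  ... | inj₂ (d , fa≡Pd , _) = just (a , length P) , a ∷ L , cut∈cuts a P d (sym fa≡Pd) , (begin
    take (length P) (f a) ++ y          ≡⟨ cong (λ t → take (length P) t ++ y) fa≡Pd ⟩
    take (length P) (P ++ d) ++ y       ≡⟨ cong (_++ y) (take-length-++ P d) ⟩
    P ++ y                              ≡⟨ e ⟩
    apply f (a ∷ L)                     ∎)
    where open ≡-Reasoning

  complete-right : ∀ u y S → y ++ S ≡ apply f u →
    ∃[ c ] ∃[ u' ] (c ∈ cuts × y ++ tail-piece c ≡ apply f u')
  complete-right [] [] [] e = nothing , [] , here refl , refl
  complete-right (a ∷ u) y S e with ++-overlap y S (f a) (apply f u) e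
  ... | inj₁ (y' , refl , e') with complete-right u y' S e'
  ...   | c , u' , c∈ , e'' = c , a ∷ u' , c∈ , trans (++-assoc (f a) y' _) (cong (f a ++_) e'')
  complete-right (a ∷ u) y S e | inj₂ (d , fa≡yd , _) =
    just (a , length y) , a ∷ [] , cut∈cuts a y d (sym fa≡yd) , (begin
    y ++ drop (length y) (f a)          ≡⟨ cong (λ t → y ++ drop (length y) t) fa≡yd ⟩
    y ++ drop (length y) (y ++ d)       ≡⟨ cong (y ++_) (drop-length-++ y d) ⟩
    y ++ d                              ≡⟨ fa≡yd ⟨
    f a                                 ≡⟨ ++-identityʳ (f a) ⟨
    apply f (a ∷ [])                    ∎)
    where open ≡-Reasoning

  Frame : List (Fin m) → Set
  Frame x = Σ (Cut × Cut) λ (c , c') →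
    (c , c') ∈ cartesianProduct cuts cuts × ∃[ u ] (head-piece c ++ x ++ tail-piece c' ≡ apply f u)

  frame : ∀ x L → IsInfix x (apply f L) → Frame x
  frame x L (P , S , e) with complete-left L P (x ++ S) e
  ... | c , u , c∈ , e' with complete-right u (head-piece c ++ x) S (trans (++-assoc (head-piece c) x S) e')
  ... | c' , u' , c'∈ , e'' =
    (c , c') , ∈-cartesianProduct⁺ c∈ c'∈ , u' , trans (sym (++-assoc (head-piece c) x _)) e''

unique-length≤ : ∀ {X : Set} (S ys : List X) → All (_∈ S) ys → Unique ys → length ys ≤ length S
unique-length≤ S [] [] [] = z≤n
unique-length≤ S (y ∷ ys) (y∈S ∷ ys⊆S) (y∉ys ∷ unique) with ∈-∃++ y∈S
... | S₁ , S₂ , refl = subst (suc (length ys) ≤_) (sym (length-++-sucʳ S₁ y S₂))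
      (s≤s (unique-length≤ (S₁ ++ S₂) ys (remove-y ys⊆S y∉ys) unique))
  where
  remove-y : ∀ {zs} → All (_∈ S₁ ++ y ∷ S₂) zs → All (λ z → ¬ y ≡ z) zs → All (_∈ S₁ ++ S₂) zs
  remove-y [] [] = []
  remove-y (z∈ ∷ zs⊆) (y≢z ∷ y∉zs) with ∈-++⁻ S₁ z∈
  ... | inj₁ z∈S₁ = ∈-++⁺ˡ z∈S₁ ∷ remove-y zs⊆ y∉zs
  ... | inj₂ (here refl) = ⊥-elim (y≢z refl)
  ... | inj₂ (there z∈S₂) = ∈-++⁺ʳ S₁ z∈S₂ ∷ remove-y zs⊆ y∉zs

pigeonhole : ∀ {A X : Set} {P : A → Set} {_≁_ : A → A → Set} (S : List X)
  (code : ∀ {x} → P x → X) → (∀ {x} (px : P x) → code px ∈ S) →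
  (∀ {x y} (px : P x) (py : P y) → x ≁ y → ¬ code px ≡ code py) →
  ∀ {xs} → All P xs → AllPairs _≁_ xs → length xs ≤ length S
pigeonhole {P = P} {_≁_} S code code∈S separates ps distinct =
  subst (_≤ length S) (length-codes ps)
    (unique-length≤ S (reduce code ps) (codes∈S ps) (codes-unique ps distinct))
  where
  length-codes : ∀ {xs} (ps : All P xs) → length (reduce code ps) ≡ length xs
  length-codes [] = refl
  length-codes (px ∷ ps) = cong suc (length-codes ps)
  codes∈S : ∀ {xs} (ps : All P xs) → All (_∈ S) (reduce code ps)
  codes∈S [] = []
  codes∈S (px ∷ ps) = code∈S px ∷ codes∈S ps
  head-distinct : ∀ {x xs} (px : P x) (ps : All P xs) → All (x ≁_) xs →
                  All (λ c → ¬ code px ≡ c) (reduce code ps)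
  head-distinct px [] [] = []
  head-distinct px (py ∷ ps) (x≁y ∷ x≁ys) = separates px py x≁y ∷ head-distinct px ps x≁ys
  codes-unique : ∀ {xs} (ps : All P xs) → AllPairs _≁_ xs → Unique (reduce code ps)
  codes-unique [] [] = []
  codes-unique (px ∷ ps) (x≁xs ∷ distinct) = head-distinct px ps x≁xs ∷ codes-unique ps distinct

-- If all images f a have Parikh vectors proportional to one vector v, then f(w)
-- has bounded Abelian complexity for every w: a factor's Abelian class is
-- determined by its length and its frame, of which there are finitely many.
bounded-of-proportional : ∀ {k m} (f : Morphism k m) (v : Fin m → ℕ) (K : Fin k → ℕ) →
  ProportionalImages f v K → (w : InfWord k) → BoundedAbelianComplexity f w
bounded-of-proportional f v K prop w = length (cartesianProduct cuts cuts) , bound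
  where
  open Cuts f
  open Proportional f v K prop
  frame-of : ∀ {x} → IsFactorOfImage f w x → Frame x
  frame-of {x} (j , x-infix) = frame x (prefix w j) x-infix
  bound : ∀ n xs → All (λ x → IsFactorOfImage f w x × length x ≡ n) xs →
          AllPairs (λ x y → ¬ (x ~ab y)) xs → length xs ≤ length (cartesianProduct cuts cuts)
  bound n xs = pigeonhole (cartesianProduct cuts cuts)
    (λ (x-fac , _) → proj₁ (frame-of x-fac)) (λ (x-fac , _) → proj₁ (proj₂ (frame-of x-fac)))
    (λ (x-fac , lx) (y-fac , ly) → separates (frame-of x-fac) (frame-of y-fac) (trans lx (sym ly)))
    where
    separates : ∀ {x y} (fx : Frame x) (fy : Frame y) → length x ≡ length y →
                ¬ (x ~ab y) → ¬ proj₁ fx ≡ proj₁ fy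
    separates {x} {y} ((c , c') , _ , u , ex) (_ , _ , u' , ey) lx≡ly x≁y refl =
      x≁y (framed-equivalent (head-piece c) (tail-piece c') x y u u' lx≡ly ex ey)

infix-trans : ∀ {m} {x y z : List (Fin m)} → IsInfix x y → IsInfix y z → IsInfix x z
infix-trans {x = x} (p , s , refl) (p' , s' , refl) = p' ++ p , s ++ s' , (begin
  (p' ++ p) ++ x ++ s ++ s'    ≡⟨ ++-assoc p' p _ ⟩
  p' ++ p ++ x ++ s ++ s'      ≡⟨ cong (λ t → p' ++ p ++ t) (++-assoc x s s') ⟨
  p' ++ p ++ (x ++ s) ++ s'    ≡⟨ cong (p' ++_) (++-assoc p (x ++ s) s') ⟨
  p' ++ (p ++ x ++ s) ++ s'    ∎)
  where open ≡-Reasoning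

infix-apply : ∀ {k m} (f : Morphism k m) {x y : List (Fin k)} →
  IsInfix x y → IsInfix (apply f x) (apply f y)
infix-apply f {x} (p , s , refl) = apply f p , apply f s ,
  sym (trans (concatMap-++ f p (x ++ s)) (cong (apply f p ++_) (concatMap-++ f x s)))

replicate-+ : ∀ {X : Set} r s (x : X) → replicate (r + s) x ≡ replicate r x ++ replicate s x
replicate-+ zero s x = refl
replicate-+ (suc r) s x = cong (x ∷_) (replicate-+ r s x)

square-infix : ∀ {k} (a a' : Fin k) {r s R} → r ≤ R → s ≤ R →
  IsInfix (replicate r a ++ replicate s a') (replicate R a ++ replicate R a')
square-infix a a' {r} {s} {R} r≤R s≤R with m≤n⇒∃[o]m+o≡n r≤R | m≤n⇒∃[o]m+o≡n s≤R
... | r' , r+r'≡R | s' , s+s'≡R = replicate r' a , replicate s' a' , (begin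
  replicate r' a ++ (replicate r a ++ replicate s a') ++ replicate s' a'
    ≡⟨ cong (replicate r' a ++_) (++-assoc (replicate r a) _ _) ⟩
  replicate r' a ++ replicate r a ++ replicate s a' ++ replicate s' a'
    ≡⟨ ++-assoc (replicate r' a) _ _ ⟨
  (replicate r' a ++ replicate r a) ++ replicate s a' ++ replicate s' a'
    ≡⟨ cong₂ _++_ (replicate-+ r' r a) (replicate-+ s s' a') ⟨
  replicate (r' + r) a ++ replicate (s + s') a'
    ≡⟨ cong₂ (λ x y → replicate x a ++ replicate y a') (trans (+-comm r' r) r+r'≡R) s+s'≡R ⟩
  replicate R a ++ replicate R a' ∎)
  where open ≡-Reasoning

-- The infinite word a² a'² a³ a'³ a⁴ a'⁴ … contains every square a^R a'^R as a
-- factor.  It is produced by a generator which emits a buffer and, once the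
-- buffer is empty, the leading a of the next block a^(N+1) a'^(N+1) followed by
-- the rest of that block as the new buffer; this keeps the recursion structural.
module SquaresWord {k} (a a' : Fin k) where

  rest : ℕ → List (Fin k)
  rest N = replicate N a ++ replicate (suc N) a'

  block : ℕ → List (Fin k)
  block N = a ∷ rest N

  emit : ℕ → List (Fin k) → ℕ → Fin k
  emit N (x ∷ xs) zero = x
  emit N (x ∷ xs) (suc i) = emit N xs i
  emit N [] zero = a
  emit N [] (suc i) = emit (suc N) (rest (suc N)) i

  word : InfWord k
  word = emit 0 []

  blocks : ℕ → ℕ → List (Fin k)
  blocks N zero = []
  blocks N (suc d) = block (suc N) ++ blocks (suc N) d

  emit-prefix : ∀ N xs d → applyUpTo (emit N xs) (length xs + length (blocks N d)) ≡ xs ++ blocks N d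
  emit-prefix N (x ∷ xs) d = cong (x ∷_) (emit-prefix N xs d)
  emit-prefix N [] zero = refl
  emit-prefix N [] (suc d) = cong (a ∷_) (trans
    (cong (applyUpTo (emit (suc N) (rest (suc N)))) (length-++ (rest (suc N))))
    (emit-prefix (suc N) (rest (suc N)) d))

  block-infix : ∀ N d → IsInfix (block (suc (N + d))) (blocks N (suc d))
  block-infix N zero = [] , [] , cong (λ t → block (suc t) ++ []) (+-identityʳ N)
  block-infix N (suc d) with block-infix (suc N) d
  ... | p , s , e = block (suc N) ++ p , s , trans (++-assoc (block (suc N)) p _)
        (cong (block (suc N) ++_) (trans (cong (λ t → p ++ block (suc t) ++ s) (+-suc N d)) e))

  squares-occur : ∀ R → ∃[ j ] IsInfix (replicate R a ++ replicate R a') (prefix word j)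
  squares-occur R = length (blocks 0 (suc R)) , infix-trans (square-infix a a' R≤2+R R≤2+R)
    (subst (IsInfix (block (suc R))) (sym (trans (map-upTo word _) (emit-prefix 0 [] (suc R))))
      (block-infix 0 R))
    where
    R≤2+R : R ≤ suc (suc R)
    R≤2+R = m≤n⇒m≤1+n (m≤n⇒m≤1+n ≤-refl)

Ψ-apply-replicate : ∀ {k m} (f : Morphism k m) r a b →
  Ψ (apply f (replicate r a)) b ≡ r * Ψ (f a) b
Ψ-apply-replicate f zero a b = refl
Ψ-apply-replicate f (suc r) a b =
  trans (count-++ b (f a) _) (cong (_+_ (Ψ (f a) b)) (Ψ-apply-replicate f r a b))

length-apply-replicate : ∀ {k m} (f : Morphism k m) r a →
  length (apply f (replicate r a)) ≡ r * length (f a)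
length-apply-replicate f zero a = refl
length-apply-replicate f (suc r) a =
  trans (length-++ (f a)) (cong (_+_ (length (f a))) (length-apply-replicate f r a))

exchange : ∀ {i j t} P Q → i < j → j ≤ t → i * P + (t ∸ i) * Q ≡ j * P + (t ∸ j) * Q → P ≡ Q
exchange {i} {j} {t} P Q i<j j≤t e with m≤n⇒∃[o]m+o≡n i<j | m≤n⇒∃[o]m+o≡n j≤t
... | o , refl | r , refl = *-cancelˡ-≡ P Q (suc o) (+-cancelˡ-≡ (i * P + r * Q) _ _ (begin
  i * P + r * Q + suc o * P                  ≡⟨ regroup-j i o r P Q ⟩
  (suc i + o) * P + r * Q                    ≡⟨ cong (λ x → (suc i + o) * P + x * Q) t∸j≡r ⟨
  (suc i + o) * P + (t ∸ (suc i + o)) * Q    ≡⟨ e ⟨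
  i * P + (t ∸ i) * Q                        ≡⟨ cong (λ x → i * P + x * Q) t∸i≡1+o+r ⟩
  i * P + (suc o + r) * Q                    ≡⟨ regroup-i i o r P Q ⟩
  i * P + r * Q + suc o * Q                  ∎))
  where
  open ≡-Reasoning
  t∸j≡r : suc i + o + r ∸ (suc i + o) ≡ r
  t∸j≡r = m+n∸m≡n (suc i + o) r
  t∸i≡1+o+r : suc i + o + r ∸ i ≡ suc o + r
  t∸i≡1+o+r = trans (cong (_∸ i) (split-off-i i o r)) (m+n∸m≡n i (suc o + r))
    where
    split-off-i : ∀ i o r → suc i + o + r ≡ i + (suc o + r)
    split-off-i = solve-∀
  regroup-j : ∀ i o r P Q → i * P + r * Q + suc o * P ≡ (suc i + o) * P + r * Q
  regroup-j = solve-∀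
  regroup-i : ∀ i o r P Q → i * P + (suc o + r) * Q ≡ i * P + r * Q + suc o * Q
  regroup-i = solve-∀

minor-of-proportional : ∀ p q xb xc yb yc → 0 < q → p * xb ≡ q * yb → p * xc ≡ q * yc →
  xb * yc ≡ yb * xc
minor-of-proportional p q@(suc _) xb xc yb yc _ eb ec = *-cancelˡ-≡ _ _ q (begin
  q * (xb * yc)    ≡⟨ swap q xb yc ⟩
  xb * (q * yc)    ≡⟨ cong (xb *_) ec ⟨
  xb * (p * xc)    ≡⟨ mirror xb p xc ⟩
  xc * (p * xb)    ≡⟨ cong (xc *_) eb ⟩
  xc * (q * yb)    ≡⟨ rotate xc q yb ⟩
  q * (yb * xc)    ∎)
  where
  open ≡-Reasoning
  swap : ∀ x y z → x * (y * z) ≡ y * (x * z)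
  swap = solve-∀
  mirror : ∀ x y z → x * (y * z) ≡ z * (y * x)
  mirror = solve-∀
  rotate : ∀ x y z → x * (y * z) ≡ y * (z * x)
  rotate = solve-∀

VanishingMinors : ∀ {k m} → Morphism k m → Set
VanishingMinors f = ∀ a a' b c → Ψ (f a) b * Ψ (f a') c ≡ Ψ (f a') b * Ψ (f a) c

-- If Ψ(f a) and Ψ(f a') are not parallel, then f(a² a'² a³ a'³ …) has unbounded
-- Abelian complexity: with p = |f a'|, q = |f a|, the factors
-- f(a^(i·p) a'^((t−i)·q)) for i = 0 … t all have length t·p·q and are pairwise
-- Abelian inequivalent, since their Parikh vectors move by p·Ψ(f a) − q·Ψ(f a') ≠ 0.
module NonParallelImages {k m} (f : Morphism k m) (a a' : Fin k) (b c : Fin m)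
  (minor≢0 : ¬ (Ψ (f a) b * Ψ (f a') c ≡ Ψ (f a') b * Ψ (f a) c)) where

  open SquaresWord a a'

  p q : ℕ
  p = length (f a')
  q = length (f a)

  -- f a is not empty, otherwise the minor would be 0.
  q-positive : 0 < q
  q-positive with f a
  ... | [] = ⊥-elim (minor≢0 (sym (*-zeroʳ (Ψ (f a') b))))
  ... | _ ∷ _ = s≤s z≤n

  sample : ℕ → ℕ → List (Fin m)
  sample t i = apply f (replicate (i * p) a ++ replicate ((t ∸ i) * q) a')

  Ψ-sample : ∀ t i z → Ψ (sample t i) z ≡ i * (p * Ψ (f a) z) + (t ∸ i) * (q * Ψ (f a') z)
  Ψ-sample t i z = begin
    Ψ (sample t i) z
      ≡⟨ cong (λ x → Ψ x z) (concatMap-++ f (replicate (i * p) a) _) ⟩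
    Ψ (apply f (replicate (i * p) a) ++ apply f (replicate ((t ∸ i) * q) a')) z
      ≡⟨ count-++ z (apply f (replicate (i * p) a)) _ ⟩
    Ψ (apply f (replicate (i * p) a)) z + Ψ (apply f (replicate ((t ∸ i) * q) a')) z
      ≡⟨ cong₂ _+_ (Ψ-apply-replicate f (i * p) a z) (Ψ-apply-replicate f ((t ∸ i) * q) a' z) ⟩
    i * p * Ψ (f a) z + (t ∸ i) * q * Ψ (f a') z
      ≡⟨ cong₂ _+_ (*-assoc i p _) (*-assoc (t ∸ i) q _) ⟩
    i * (p * Ψ (f a) z) + (t ∸ i) * (q * Ψ (f a') z) ∎
    where open ≡-Reasoning

  length-sample : ∀ t i → i ≤ t → length (sample t i) ≡ t * (p * q)
  length-sample t i i≤t = begin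
    length (sample t i)
      ≡⟨ cong length (concatMap-++ f (replicate (i * p) a) _) ⟩
    length (apply f (replicate (i * p) a) ++ apply f (replicate ((t ∸ i) * q) a'))
      ≡⟨ length-++ (apply f (replicate (i * p) a)) ⟩
    length (apply f (replicate (i * p) a)) + length (apply f (replicate ((t ∸ i) * q) a'))
      ≡⟨ cong₂ _+_ (length-apply-replicate f (i * p) a) (length-apply-replicate f ((t ∸ i) * q) a') ⟩
    i * p * q + (t ∸ i) * q * p
      ≡⟨ regroup i (t ∸ i) p q ⟩
    (i + (t ∸ i)) * (p * q)
      ≡⟨ cong (_* (p * q)) (m+[n∸m]≡n i≤t) ⟩
    t * (p * q) ∎
    where
    open ≡-Reasoning
    regroup : ∀ i j p q → i * p * q + j * q * p ≡ (i + j) * (p * q)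
    regroup = solve-∀

  -- Samples are factors of f(word), being images of factors of a square.
  sample-factor : ∀ t i → i ≤ t → IsFactorOfImage f word (sample t i)
  sample-factor t i i≤t with squares-occur (t * (p + q))
  ... | j , square⊑prefix = j , infix-apply f (infix-trans (square-infix a a' ip≤ tq≤) square⊑prefix)
    where
    ip≤ : i * p ≤ t * (p + q)
    ip≤ = ≤-trans (*-monoˡ-≤ p i≤t) (*-monoʳ-≤ t (m≤m+n p q))
    tq≤ : (t ∸ i) * q ≤ t * (p + q)
    tq≤ = ≤-trans (*-monoˡ-≤ q (m∸n≤m t i)) (*-monoʳ-≤ t (m≤n+m q p))

  -- Equivalent samples would give p·Ψ(f a) = q·Ψ(f a'), making the minor vanish.
  samples-inequivalent : ∀ t i j → i < j → j ≤ t → ¬ (sample t i ~ab sample t j)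
  samples-inequivalent t i j i<j j≤t equivalent = minor≢0
    (minor-of-proportional p q _ _ _ _ q-positive (parallel b) (parallel c))
    where
    parallel : ∀ z → p * Ψ (f a) z ≡ q * Ψ (f a') z
    parallel z = exchange _ _ i<j j≤t
      (trans (sym (Ψ-sample t i z)) (trans (equivalent z) (Ψ-sample t j z)))

  -- The C+1 samples of size C exceed any bound C.
  unbounded : ¬ BoundedAbelianComplexity f word
  unbounded (C , bound) = 1+n≰n (subst (_≤ C) (length-applyUpTo (sample C) (suc C))
    (bound (C * (p * q)) (applyUpTo (sample C) (suc C))
      (All.applyUpTo⁺₁ (sample C) (suc C) (λ {i} i<1+C → sample-factor C i (≤-pred i<1+C) ,
                                                       length-sample C i (≤-pred i<1+C)))
      (AllPairs.applyUpTo⁺₁ (sample C) (suc C)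
        (λ {i} {j} i<j j<1+C → samples-inequivalent C i j i<j (≤-pred j<1+C)))))

minors-of-bounded : ∀ {k m} (f : Morphism k m) →
  ((w : InfWord k) → BoundedAbelianComplexity f w) → VanishingMinors f
minors-of-bounded f bounded a a' b c with Ψ (f a) b * Ψ (f a') c ℕ.≟ Ψ (f a') b * Ψ (f a) c
... | yes minor≡0 = minor≡0
... | no minor≢0 = ⊥-elim (NonParallelImages.unbounded f a a' b c minor≢0 (bounded _))

gcdᵥ : ∀ {m} → (Fin m → ℕ) → ℕ
gcdᵥ {zero} x = 0
gcdᵥ {suc m} x = gcd (x zero) (gcdᵥ (λ b → x (suc b)))

gcdᵥ∣ : ∀ {m} (x : Fin m → ℕ) b → gcdᵥ x ∣ x b
gcdᵥ∣ x zero = gcd[m,n]∣m (x zero) _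
gcdᵥ∣ x (suc b) = ∣-trans (gcd[m,n]∣n (x zero) _) (gcdᵥ∣ (λ c → x (suc c)) b)

∣gcdᵥ : ∀ {m} (x : Fin m → ℕ) {d} → (∀ b → d ∣ x b) → d ∣ gcdᵥ x
∣gcdᵥ {zero} x d∣x = divides 0 refl
∣gcdᵥ {suc m} x d∣x = gcd-greatest (d∣x zero) (∣gcdᵥ (λ b → x (suc b)) (d∣x ∘ suc))

gcdᵥ-scale : ∀ {m} (x y : Fin m → ℕ) c → (∀ b → y b ≡ c * x b) → gcdᵥ y ≡ c * gcdᵥ x
gcdᵥ-scale {zero} x y c y≡cx = sym (*-zeroʳ c)
gcdᵥ-scale {suc m} x y c y≡cx =
  trans (cong₂ gcd (y≡cx zero) (gcdᵥ-scale (λ b → x (suc b)) (λ b → y (suc b)) c (y≡cx ∘ suc)))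
        (sym (c*gcd[m,n]≡gcd[cm,cn] c (x zero) _))

primitive-decomposition : ∀ {m} (u : Fin m → ℕ) b₀ → 0 < u b₀ →
  Σ ℕ λ g → Σ (Fin m → ℕ) λ v → 0 < g × gcdᵥ v ≡ 1 × (∀ b → u b ≡ g * v b)
primitive-decomposition u b₀ u₀>0 = g , v , g>0 , gcd-v≡1 , u≡gv
  where
  g : ℕ
  g = gcdᵥ u
  v : _ → ℕ
  v b = quotient (gcdᵥ∣ u b)
  u≡gv : ∀ b → u b ≡ g * v b
  u≡gv b = trans (_∣_.equality (gcdᵥ∣ u b)) (*-comm (v b) g)
  g>0 : 0 < g
  g>0 with g in g≡
  ... | suc _ = s≤s z≤n
  ... | zero = ⊥-elim (<⇒≢ u₀>0 (sym (0∣⇒≡0 (subst (_∣ u b₀) g≡ (gcdᵥ∣ u b₀)))))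
  gcd-v≡1 : gcdᵥ v ≡ 1
  gcd-v≡1 = sym (*-cancelˡ-≡ 1 (gcdᵥ v) g {{>-nonZero g>0}}
    (trans (*-identityʳ g) (gcdᵥ-scale v u g u≡gv)))

-- A vector x parallel to a primitive vector v is a multiple K · v of it:
-- v b₀ divides x b₀ · v b for every b, hence x b₀ · gcd v = x b₀.
multiple-of-primitive : ∀ {m} (v x : Fin m → ℕ) b₀ → gcdᵥ v ≡ 1 → 0 < v b₀ →
  (∀ b → v b₀ * x b ≡ x b₀ * v b) → Σ ℕ λ K → ∀ b → x b ≡ K * v b
multiple-of-primitive v x b₀ gcd-v≡1 v₀>0 parallel = K , x≡Kv
  where
  v₀∣x₀v : ∀ b → v b₀ ∣ x b₀ * v b
  v₀∣x₀v b = divides (x b) (trans (sym (parallel b)) (*-comm (v b₀) (x b)))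
  v₀∣x₀ : v b₀ ∣ x b₀
  v₀∣x₀ = subst (v b₀ ∣_) (trans (gcdᵥ-scale v (λ b → x b₀ * v b) (x b₀) (λ b → refl))
                                 (trans (cong (x b₀ *_) gcd-v≡1) (*-identityʳ (x b₀))))
    (∣gcdᵥ (λ b → x b₀ * v b) v₀∣x₀v)
  K : ℕ
  K = quotient v₀∣x₀
  x≡Kv : ∀ b → x b ≡ K * v b
  x≡Kv b = *-cancelˡ-≡ (x b) (K * v b) (v b₀) {{>-nonZero v₀>0}} (begin
    v b₀ * x b          ≡⟨ parallel b ⟩
    x b₀ * v b          ≡⟨ cong (_* v b) (_∣_.equality v₀∣x₀) ⟩
    K * v b₀ * v b      ≡⟨ rearrange K (v b₀) (v b) ⟩
    v b₀ * (K * v b)    ∎)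
    where
    open ≡-Reasoning
    rearrange : ∀ K w y → K * w * y ≡ w * (K * y)
    rearrange = solve-∀

-- Vanishing minors give proportional images: all Ψ(f a) are multiples of the
-- primitive vector on the line spanned by any nonzero Ψ(f a₀) (v = 0 if there is none).
proportional-of-minors : ∀ {k m} (f : Morphism k m) → VanishingMinors f →
  Σ (Fin m → ℕ) λ v → Σ (Fin k → ℕ) λ K → ProportionalImages f v K
proportional-of-minors f minors with any? (λ a → any? (λ b → 0 <? Ψ (f a) b))
... | no all-zero = (λ _ → 0) , (λ _ → 0) , Ψ≡0
  where
  Ψ≡0 : ∀ a b → Ψ (f a) b ≡ 0
  Ψ≡0 a b with Ψ (f a) b in Ψab
  ... | zero = refl
  ... | suc _ = ⊥-elim (all-zero (a , b , subst (0 <_) (sym Ψab) (s≤s z≤n)))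
... | yes (a₀ , b₀ , Ψ₀>0) with primitive-decomposition (Ψ (f a₀)) b₀ Ψ₀>0
...   | g , v , g>0 , gcd-v≡1 , Ψ₀≡gv = v , proj₁ ∘ multiple , proj₂ ∘ multiple
  where
  v₀>0 : 0 < v b₀
  v₀>0 with v b₀ in v₀≡
  ... | suc _ = s≤s z≤n
  ... | zero = ⊥-elim (<⇒≢ Ψ₀>0 (sym (trans (Ψ₀≡gv b₀) (trans (cong (g *_) v₀≡) (*-zeroʳ g)))))
  parallel : ∀ a b → v b₀ * Ψ (f a) b ≡ Ψ (f a) b₀ * v b
  parallel a b = *-cancelˡ-≡ _ _ g {{>-nonZero g>0}} (begin
    g * (v b₀ * Ψ (f a) b)       ≡⟨ *-assoc g (v b₀) _ ⟨
    g * v b₀ * Ψ (f a) b         ≡⟨ cong (_* Ψ (f a) b) (Ψ₀≡gv b₀) ⟨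
    Ψ (f a₀) b₀ * Ψ (f a) b      ≡⟨ minors a₀ a b₀ b ⟩
    Ψ (f a) b₀ * Ψ (f a₀) b      ≡⟨ cong (Ψ (f a) b₀ *_) (Ψ₀≡gv b) ⟩
    Ψ (f a) b₀ * (g * v b)       ≡⟨ swap (Ψ (f a) b₀) g (v b) ⟩
    g * (Ψ (f a) b₀ * v b)       ∎)
    where
    open ≡-Reasoning
    swap : ∀ x y z → x * (y * z) ≡ y * (x * z)
    swap = solve-∀
  multiple : ∀ a → Σ ℕ λ K → ∀ b → Ψ (f a) b ≡ K * v b
  multiple a = multiple-of-primitive v (Ψ (f a)) b₀ gcd-v≡1 v₀>0 (parallel a)

IntegerMultiples : ∀ {k m} → Morphism k m → Set
IntegerMultiples {k} {m} f =
  Σ (Fin m → ℕ) λ v → ((a : Fin k) → Σ ℤ λ K → ((b : Fin m) → + Ψ (f a) b ≡ K *ℤ + v b))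

natural-coefficient : ∀ {c w} (K : ℤ) → + c ≡ K *ℤ + w → c ≡ ∣ K ∣ * w
natural-coefficient {w = w} K e = trans (cong ∣_∣ e) (abs-* K (+ w))

mainTheorem4 : (k m : ℕ) (f : Morphism k m) →
    ((w : InfWord k) → BoundedAbelianComplexity f w) ⇔
    (Σ (Fin m → ℕ) λ v → ((a : Fin k) → Σ ℤ λ K → ((b : Fin m) → + Ψ (f a) b ≡ K *ℤ + v b)))
mainTheorem4 k m f = mk⇔ necessary sufficient
  where
  necessary : ((w : InfWord k) → BoundedAbelianComplexity f w) → IntegerMultiples f
  necessary bounded with proportional-of-minors f (minors-of-bounded f bounded)
  ... | v , K , prop = v , λ a → + K a , λ b → trans (cong +_ (prop a b)) (pos-* (K a) (v b))
  sufficient : IntegerMultiples f → (w : InfWord k) → BoundedAbelianComplexity f w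
  sufficient (v , K) = bounded-of-proportional f v (λ a → ∣ proj₁ (K a) ∣)
    (λ a b → natural-coefficient (proj₁ (K a)) (proj₂ (K a) b))
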